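{- Let $\Gamma$ be an environment and $\sigma$ a substitution such that $\Gamma$ is compatible with $\sigma$, and let $M$ be a metaterm of $\lambda^{\to}_{\mathfrak m}$ such that $M^{\Gamma} \twoheadrightarrow \star$. Then $M^{\sigma} \twoheadrightarrow \star$.
   Context: Simple types: $A,B ::= \mathbf{a} \mid A\Rightarrow B$ with $\mathbf{a}$ atomic. An environment $\Gamma$ is a finite set of assignments $x:A$ to distinct variables. The metacalculus $\lambda^{\to}_{\mathfrak m}$ has metaterms $M,N ::= x \mid \lambda x.M \mid M\,N \mid \star \mid (M \triangleright N) \mid \mathrm{gen}_{\mathbf{a}} \mid \mathrm{ver}_{\mathbf{a}}(M)$ for atomic $\mathbf{a}$. For arbitrary types: $\mathrm{gen}_{A\Rightarrow B} := \lambda x.(\mathrm{ver}_A(x) \triangleright \mathrm{gen}_B)$ ($x$ fresh) and $\mathrm{ver}_{A \Rightarrow B}(M) := \mathrm{ver}_B(M\,\mathrm{gen}_A)$. Reduction $\to$ is the closure under arbitrary contexts of $(\lambda x.M)\,N \to M\{x:=N\}$, $(\star \triangleright M) \to M$, $\mathrm{ver}_{\mathbf{a}}(\mathrm{gen}_{\mathbf{a}}) \to \star$; $\twoheadrightarrow$ is its reflexive-transitive closure. A substitution $\sigma$ maps variables (those in its domain $\mathrm{dom}(\sigma)$) to metaterms; $M^{\sigma}$ is the capture-avoiding simultaneous replacement of each free variable $x\in\mathrm{dom}(\sigma)$ by $\sigma(x)$. $M^{\Gamma}$ denotes $M^{\sigma_\Gamma}$ where $\sigma_\Gamma(x)=\mathrm{gen}_A$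 for $x:A\in\Gamma$ and $\sigma_\Gamma(x)=x$ otherwise. $\Gamma$ is compatible with $\sigma$ if for every $x:A\in\Gamma$ we have $x\in\mathrm{dom}(\sigma)$ and $\mathrm{ver}_A(x^{\sigma}) \twoheadrightarrow \star$. -}

module Defs where

open import Data.Nat using (ℕ; zero; suc; _≟_)
open import Data.Maybe using (Maybe; just; nothing)
open import Data.Product using (_×_; _,_; proj₁; ∃-syntax)
open import Data.List using (List; []; _∷_; map)
open import Data.List.Membership.Propositional using (_∈_)
open import Data.List.Relation.Unary.Unique.Propositional using (Unique)
open import Relation.Nullary using (yes; no)
open import Relation.Binary.PropositionalEquality using (_≡_)
open import Relation.Binary.Construct.Closure.ReflexiveTransitive using (Star)

infixr 30 _⇒_
data Ty : Set where
  atom : ℕ → Ty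
  _⇒_  : Ty → Ty → Ty

-- Metaterms of λ→_m, with variables as de Bruijn indices
-- (so terms are identified up to α-conversion).
data Tm : Set where
  var  : ℕ → Tm
  lam  : Tm → Tm
  app  : Tm → Tm → Tm
  star : Tm
  _▷_  : Tm → Tm → Tm
  gen  : ℕ → Tm
  ver  : ℕ → Tm → Tm

ext : (ℕ → ℕ) → ℕ → ℕ
ext ρ zero    = zero
ext ρ (suc x) = suc (ρ x)

rename : (ℕ → ℕ) → Tm → Tm
rename ρ (var x)   = var (ρ x)
rename ρ (lam M)   = lam (rename (ext ρ) M)
rename ρ (app M N) = app (rename ρ M) (rename ρ N)
rename ρ star      = star
rename ρ (M ▷ N)   = rename ρ M ▷ rename ρ N
rename ρ (gen a)   = gen a
rename ρ (ver a M) = ver a (rename ρ M)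

exts : (ℕ → Tm) → ℕ → Tm
exts s zero    = var zero
exts s (suc x) = rename suc (s x)

subst : (ℕ → Tm) → Tm → Tm
subst s (var x)   = s x
subst s (lam M)   = lam (subst (exts s) M)
subst s (app M N) = app (subst s M) (subst s N)
subst s star      = star
subst s (M ▷ N)   = subst s M ▷ subst s N
subst s (gen a)   = gen a
subst s (ver a M) = ver a (subst s M)

_[_] : Tm → Tm → Tm
M [ N ] = subst σ₀ M
  where
  σ₀ : ℕ → Tm
  σ₀ zero    = N
  σ₀ (suc x) = var x

-- gen_A and ver_A(M) for arbitrary types.
-- gen_{A⇒B} = λx.(ver_A(x) ▷ gen_B)   (gen_B is closed)
mutual
  genT : Ty → Tm
  genT (atom a) = gen a
  genT (A ⇒ B)  = lam (verT A (var zero) ▷ genT B)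

  verT : Ty → Tm → Tm
  verT (atom a) M = ver a M
  verT (A ⇒ B) M  = verT B (app M (genT A))

infix 4 _⟶_
data _⟶_ : Tm → Tm → Set where
  β       : ∀ {M N} → app (lam M) N ⟶ M [ N ]
  ▷-star  : ∀ {M} → (star ▷ M) ⟶ M
  ver-gen : ∀ {a} → ver a (gen a) ⟶ star
  ξ-lam   : ∀ {M M'} → M ⟶ M' → lam M ⟶ lam M'
  ξ-appˡ  : ∀ {M M' N} → M ⟶ M' → app M N ⟶ app M' N
  ξ-appʳ  : ∀ {M N N'} → N ⟶ N' → app M N ⟶ app M N'
  ξ-▷ˡ    : ∀ {M M' N} → M ⟶ M' → (M ▷ N) ⟶ (M' ▷ N)
  ξ-▷ʳ    : ∀ {M N N'} → N ⟶ N' → (M ▷ N) ⟶ (M ▷ N')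
  ξ-ver   : ∀ {a M M'} → M ⟶ M' → ver a M ⟶ ver a M'

infix 4 _↠_
_↠_ : Tm → Tm → Set
_↠_ = Star _⟶_

-- A substitution with domain: σ x = just N means x ∈ dom(σ) and σ(x) = N.
Subst : Set
Subst = ℕ → Maybe Tm

toSub : Subst → ℕ → Tm
toSub σ x with σ x
... | just N  = N
... | nothing = var x

_^_ : Tm → Subst → Tm
M ^ σ = subst (toSub σ) M

Env : Set
Env = List (ℕ × Ty)

IsEnv : Env → Set
IsEnv Γ = Unique (map proj₁ Γ)

lookupEnv : Env → ℕ → Maybe Ty
lookupEnv []            x = nothing
lookupEnv ((y , A) ∷ Γ) x with x ≟ y
... | yes _ = just A
... | no  _ = lookupEnv Γ x

envSubst : Env → Subst
envSubst Γ x with lookupEnv Γ x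
... | just A  = just (genT A)
... | nothing = nothing

_^ᴱ_ : Tm → Env → Tm
M ^ᴱ Γ = M ^ envSubst Γ

Compatible : Env → Subst → Set
Compatible Γ σ =
  ∀ x A → (x , A) ∈ Γ → ∃[ N ] (σ x ≡ just N × verT A N ↠ star)

-- Relate a term M to a term N whenever N arises from M by replacing occurrences of
-- gen_A by terms P with ver_A(P) ↠ ★; then (M^Γ)^σ is related to M^σ.  Every reduction
-- step of the left term is matched by reductions of the right one.  The only real work
-- is the β-step gen_{A⇒B} Q ⟶ ver_A(Q) ▷ gen_B against P Q: once ver_A(Q) has reached ★,
-- gen_B is matched by P Q, because ver_B(P gen_A) ↠ ★ turns into ver_B(P Q) ↠ ★ by the
-- same theorem for the strictly smaller type A.  Hence the relation is indexed by a bound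
-- on the size of the replaced types and the argument is an induction on that bound.
module Submission where

open import Defs
open import Data.Nat using (ℕ; zero; suc; _≤_; _<_; _⊔_; s≤s; _≟_)
open import Data.Nat.Properties using (≤-refl; ≤-trans; <⇒≤; m≤m⊔n; m≤n⊔m)
open import Data.Nat.Induction using (<-rec)
open import Data.Maybe using (just; nothing)
open import Data.Product using (_×_; _,_; ∃-syntax)
open import Data.Empty using (⊥-elim)
open import Data.List using ([]; _∷_)
open import Data.List.Membership.Propositional using (_∈_)
open import Data.List.Relation.Unary.Any using (here; there)
open import Function using (_∘_)
open import Relation.Nullary using (¬_; yes; no)
open import Relation.Binary.PropositionalEquality
  using (_≡_; _≢_; _≗_; refl; sym; trans; cong; cong₂; subst₂; module ≡-Reasoning)
  renaming (subst to ≡-subst)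
open import Relation.Binary.Construct.Closure.ReflexiveTransitive using (ε; _◅_; _◅◅_; gmap)

private variable
  k x a : ℕ
  A B : Ty
  M M′ M₁ N N′ P P′ Q X X′ : Tm
  ρ τ : ℕ → ℕ
  s t : ℕ → Tm

ext-cong : ρ ≗ τ → ext ρ ≗ ext τ
ext-cong eq zero    = refl
ext-cong eq (suc x) = cong suc (eq x)

rename-cong : ρ ≗ τ → ∀ M → rename ρ M ≡ rename τ M
rename-cong eq (var x)   = cong var (eq x)
rename-cong eq (lam M)   = cong lam (rename-cong (ext-cong eq) M)
rename-cong eq (app M N) = cong₂ app (rename-cong eq M) (rename-cong eq N)
rename-cong eq star      = refl
rename-cong eq (M ▷ N)   = cong₂ _▷_ (rename-cong eq M) (rename-cong eq N)
rename-cong eq (gen a)   = refl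
rename-cong eq (ver a M) = cong (ver a) (rename-cong eq M)

exts-cong : s ≗ t → exts s ≗ exts t
exts-cong eq zero    = refl
exts-cong eq (suc x) = cong (rename suc) (eq x)

subst-cong : s ≗ t → ∀ M → subst s M ≡ subst t M
subst-cong eq (var x)   = eq x
subst-cong eq (lam M)   = cong lam (subst-cong (exts-cong eq) M)
subst-cong eq (app M N) = cong₂ app (subst-cong eq M) (subst-cong eq N)
subst-cong eq star      = refl
subst-cong eq (M ▷ N)   = cong₂ _▷_ (subst-cong eq M) (subst-cong eq N)
subst-cong eq (gen a)   = refl
subst-cong eq (ver a M) = cong (ver a) (subst-cong eq M)

ext-∘ : ∀ ρ τ → ext ρ ∘ ext τ ≗ ext (ρ ∘ τ)
ext-∘ ρ τ zero    = refl
ext-∘ ρ τ (suc x) = refl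

rename-rename : ∀ ρ τ M → rename ρ (rename τ M) ≡ rename (ρ ∘ τ) M
rename-rename ρ τ (var x)   = refl
rename-rename ρ τ (lam M)   =
  cong lam (trans (rename-rename (ext ρ) (ext τ) M) (rename-cong (ext-∘ ρ τ) M))
rename-rename ρ τ (app M N) = cong₂ app (rename-rename ρ τ M) (rename-rename ρ τ N)
rename-rename ρ τ star      = refl
rename-rename ρ τ (M ▷ N)   = cong₂ _▷_ (rename-rename ρ τ M) (rename-rename ρ τ N)
rename-rename ρ τ (gen a)   = refl
rename-rename ρ τ (ver a M) = cong (ver a) (rename-rename ρ τ M)

exts-∘-ext : ∀ s τ → exts s ∘ ext τ ≗ exts (s ∘ τ)
exts-∘-ext s τ zero    = refl
exts-∘-ext s τ (suc x) = refl

subst-rename : ∀ s τ M → subst s (rename τ M) ≡ subst (s ∘ τ) M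
subst-rename s τ (var x)   = refl
subst-rename s τ (lam M)   =
  cong lam (trans (subst-rename (exts s) (ext τ) M) (subst-cong (exts-∘-ext s τ) M))
subst-rename s τ (app M N) = cong₂ app (subst-rename s τ M) (subst-rename s τ N)
subst-rename s τ star      = refl
subst-rename s τ (M ▷ N)   = cong₂ _▷_ (subst-rename s τ M) (subst-rename s τ N)
subst-rename s τ (gen a)   = refl
subst-rename s τ (ver a M) = cong (ver a) (subst-rename s τ M)

rename-∘-exts : ∀ ρ s → rename (ext ρ) ∘ exts s ≗ exts (rename ρ ∘ s)
rename-∘-exts ρ s zero    = refl
rename-∘-exts ρ s (suc x) =
  trans (rename-rename (ext ρ) suc (s x)) (sym (rename-rename suc ρ (s x)))

rename-subst : ∀ ρ s M → rename ρ (subst s M) ≡ subst (rename ρ ∘ s) M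
rename-subst ρ s (var x)   = refl
rename-subst ρ s (lam M)   =
  cong lam (trans (rename-subst (ext ρ) (exts s) M) (subst-cong (rename-∘-exts ρ s) M))
rename-subst ρ s (app M N) = cong₂ app (rename-subst ρ s M) (rename-subst ρ s N)
rename-subst ρ s star      = refl
rename-subst ρ s (M ▷ N)   = cong₂ _▷_ (rename-subst ρ s M) (rename-subst ρ s N)
rename-subst ρ s (gen a)   = refl
rename-subst ρ s (ver a M) = cong (ver a) (rename-subst ρ s M)

subst-∘-exts : ∀ s t → subst (exts s) ∘ exts t ≗ exts (subst s ∘ t)
subst-∘-exts s t zero    = refl
subst-∘-exts s t (suc x) =
  trans (subst-rename (exts s) suc (t x)) (sym (rename-subst suc s (t x)))

subst-subst : ∀ s t M → subst s (subst t M) ≡ subst (subst s ∘ t) M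
subst-subst s t (var x)   = refl
subst-subst s t (lam M)   =
  cong lam (trans (subst-subst (exts s) (exts t) M) (subst-cong (subst-∘-exts s t) M))
subst-subst s t (app M N) = cong₂ app (subst-subst s t M) (subst-subst s t N)
subst-subst s t star      = refl
subst-subst s t (M ▷ N)   = cong₂ _▷_ (subst-subst s t M) (subst-subst s t N)
subst-subst s t (gen a)   = refl
subst-subst s t (ver a M) = cong (ver a) (subst-subst s t M)

exts-var : exts var ≗ var
exts-var zero    = refl
exts-var (suc x) = refl

subst-var : ∀ M → subst var M ≡ M
subst-var (var x)   = refl
subst-var (lam M)   = cong lam (trans (subst-cong exts-var M) (subst-var M))
subst-var (app M N) = cong₂ app (subst-var M) (subst-var N)
subst-var star      = refl
subst-var (M ▷ N)   = cong₂ _▷_ (subst-var M) (subst-var N)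
subst-var (gen a)   = refl
subst-var (ver a M) = cong (ver a) (subst-var M)

var-∘-ext : ∀ ρ → var ∘ ext ρ ≗ exts (var ∘ ρ)
var-∘-ext ρ zero    = refl
var-∘-ext ρ (suc x) = refl

rename-as-subst : ∀ ρ M → rename ρ M ≡ subst (var ∘ ρ) M
rename-as-subst ρ (var x)   = refl
rename-as-subst ρ (lam M)   =
  cong lam (trans (rename-as-subst (ext ρ) M) (subst-cong (var-∘-ext ρ) M))
rename-as-subst ρ (app M N) = cong₂ app (rename-as-subst ρ M) (rename-as-subst ρ N)
rename-as-subst ρ star      = refl
rename-as-subst ρ (M ▷ N)   = cong₂ _▷_ (rename-as-subst ρ M) (rename-as-subst ρ N)
rename-as-subst ρ (gen a)   = refl
rename-as-subst ρ (ver a M) = cong (ver a) (rename-as-subst ρ M)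

singleSubst : Tm → ℕ → Tm
singleSubst N zero    = N
singleSubst N (suc x) = var x

[]-as-subst : ∀ M N → M [ N ] ≡ subst (singleSubst N) M
[]-as-subst M N = subst-cong (λ { zero → refl ; (suc x) → refl }) M

subst-[] : ∀ s M N → subst s (M [ N ]) ≡ subst (exts s) M [ subst s N ]
subst-[] s M N = begin
  subst s (M [ N ])                                ≡⟨ cong (subst s) ([]-as-subst M N) ⟩
  subst s (subst (singleSubst N) M)                ≡⟨ subst-subst s (singleSubst N) M ⟩
  subst (subst s ∘ singleSubst N) M                ≡⟨ subst-cong commute M ⟩
  subst (subst (singleSubst (subst s N)) ∘ exts s) M
    ≡⟨ sym (subst-subst (singleSubst (subst s N)) (exts s) M) ⟩
  subst (singleSubst (subst s N)) (subst (exts s) M) ≡⟨ sym ([]-as-subst (subst (exts s) M) (subst s N)) ⟩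
  subst (exts s) M [ subst s N ]                   ∎
  where
  open ≡-Reasoning
  commute : subst s ∘ singleSubst N ≗ subst (singleSubst (subst s N)) ∘ exts s
  commute zero    = refl
  commute (suc x) =
    sym (trans (subst-rename (singleSubst (subst s N)) suc (s x)) (subst-var (s x)))

mutual
  subst-genT : ∀ s A → subst s (genT A) ≡ genT A
  subst-genT s (atom a) = refl
  subst-genT s (A ⇒ B)  =
    cong lam (cong₂ _▷_ (subst-verT (exts s) A (var zero)) (subst-genT (exts s) B))

  subst-verT : ∀ s A M → subst s (verT A M) ≡ verT A (subst s M)
  subst-verT s (atom a) M = refl
  subst-verT s (A ⇒ B)  M =
    trans (subst-verT s B (app M (genT A)))
          (cong (λ G → verT B (app (subst s M) G)) (subst-genT s A))

rename-genT : ∀ ρ A → rename ρ (genT A) ≡ genT A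
rename-genT ρ A = trans (rename-as-subst ρ (genT A)) (subst-genT (var ∘ ρ) A)

genT-⇒-[] : ∀ A B P → (verT A (var zero) ▷ genT B) [ P ] ≡ (verT A P ▷ genT B)
genT-⇒-[] A B P = trans ([]-as-subst (verT A (var zero) ▷ genT B) P)
  (cong₂ _▷_ (subst-verT (singleSubst P) A (var zero)) (subst-genT (singleSubst P) B))

⟶-subst : ∀ s → M ⟶ M′ → subst s M ⟶ subst s M′
⟶-subst s (β {M} {N}) =
  ≡-subst (app (lam (subst (exts s) M)) (subst s N) ⟶_) (sym (subst-[] s M N)) β
⟶-subst s ▷-star     = ▷-star
⟶-subst s ver-gen    = ver-gen
⟶-subst s (ξ-lam r)  = ξ-lam (⟶-subst (exts s) r)
⟶-subst s (ξ-appˡ r) = ξ-appˡ (⟶-subst s r)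
⟶-subst s (ξ-appʳ r) = ξ-appʳ (⟶-subst s r)
⟶-subst s (ξ-▷ˡ r)   = ξ-▷ˡ (⟶-subst s r)
⟶-subst s (ξ-▷ʳ r)   = ξ-▷ʳ (⟶-subst s r)
⟶-subst s (ξ-ver r)  = ξ-ver (⟶-subst s r)

↠-subst : ∀ s → M ↠ M′ → subst s M ↠ subst s M′
↠-subst s = gmap (subst s) (⟶-subst s)

verT-↠-subst : ∀ s A → verT A N ↠ P → verT A (subst s N) ↠ subst s P
verT-↠-subst {N} {P} s A r = ≡-subst (_↠ subst s P) (subst-verT s A N) (↠-subst s r)

verT-↠-rename : ∀ ρ A → verT A N ↠ P → verT A (rename ρ N) ↠ rename ρ P
verT-↠-rename {N} {P} ρ A r =
  subst₂ _↠_ (cong (verT A) (sym (rename-as-subst ρ N))) (sym (rename-as-subst ρ P))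
    (verT-↠-subst (var ∘ ρ) A r)

Normal : Tm → Set
Normal M = ∀ {M′} → ¬ (M ⟶ M′)

data Neutral : Tm → Set where
  var : Neutral (var x)
  app : Neutral M → Normal N → Neutral (app M N)

neutral⇒normal : Neutral M → Normal M
neutral⇒normal (app () _)   β
neutral⇒normal (app ne _)  (ξ-appˡ r) = neutral⇒normal ne r
neutral⇒normal (app _ nf)  (ξ-appʳ r) = nf r

▷-normal : Normal M → Normal N → M ≢ star → Normal (M ▷ N)
▷-normal _   _   M≢star ▷-star   = M≢star refl
▷-normal nfM _   _      (ξ-▷ˡ r) = nfM r
▷-normal _   nfN _      (ξ-▷ʳ r) = nfN r

verT≢star : ∀ A M → verT A M ≢ star
verT≢star (atom a) M ()
verT≢star (A ⇒ B)  M = verT≢star B (app M (genT A))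

mutual
  genT-normal : ∀ A → Normal (genT A)
  genT-normal (atom a) ()
  genT-normal (A ⇒ B)  (ξ-lam r) =
    ▷-normal (verT-normal A var) (genT-normal B) (verT≢star A (var zero)) r

  verT-normal : ∀ A → Neutral M → Normal (verT A M)
  verT-normal (atom a) ne (ξ-ver r) = neutral⇒normal ne r
  verT-normal (A ⇒ B)  ne r         = verT-normal B (app ne (genT-normal A)) r

size : Ty → ℕ
size (atom a) = zero
size (A ⇒ B)  = suc (size A ⊔ size B)

dom-size< : size (A ⇒ B) ≤ k → size A < k
dom-size< {A} {B} sz = ≤-trans (s≤s (m≤m⊔n (size A) (size B))) sz

cod-size≤ : size (A ⇒ B) ≤ k → size B ≤ k
cod-size≤ {A} {B} sz = <⇒≤ (≤-trans (s≤s (m≤n⊔m (size A) (size B))) sz)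

-- Approx k M N: N is M with some occurrences of gen_A, size A ≤ k, replaced by terms
-- P with ver_A(P) ↠ ★; gen-⇒-applied covers the β-reduct of such an occurrence
-- applied to an argument.
data Approx (k : ℕ) : Tm → Tm → Set where
  var  : Approx k (var x) (var x)
  lam  : Approx k M M′ → Approx k (lam M) (lam M′)
  app  : Approx k M M′ → Approx k N N′ → Approx k (app M N) (app M′ N′)
  star : Approx k star star
  _▷_  : Approx k M M′ → Approx k N N′ → Approx k (M ▷ N) (M′ ▷ N′)
  gen  : Approx k (gen a) (gen a)
  ver  : Approx k M M′ → Approx k (ver a M) (ver a M′)
  gen-atom : ver a N ↠ star → Approx k (gen a) N
  gen-⇒ : size (A ⇒ B) ≤ k → verT (A ⇒ B) N ↠ star → Approx k (genT (A ⇒ B)) N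
  gen-⇒-applied : size (A ⇒ B) ≤ k → verT (A ⇒ B) N ↠ star →
                  Approx k X X′ → verT A Q ↠ X′ → Approx k (X ▷ genT B) (app N Q)

Approx-refl : ∀ M → Approx k M M
Approx-refl (var x)   = var
Approx-refl (lam M)   = lam (Approx-refl M)
Approx-refl (app M N) = app (Approx-refl M) (Approx-refl N)
Approx-refl star      = star
Approx-refl (M ▷ N)   = Approx-refl M ▷ Approx-refl N
Approx-refl (gen a)   = gen
Approx-refl (ver a M) = ver (Approx-refl M)

genT-approx : ∀ A → size A ≤ k → verT A N ↠ star → Approx k (genT A) N
genT-approx (atom a) _  r = gen-atom r
genT-approx (A ⇒ B)  sz r = gen-⇒ sz r

verT-approx : ∀ A → Approx k M M′ → Approx k (verT A M) (verT A M′)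
verT-approx (atom a) r = ver r
verT-approx (A ⇒ B)  r = verT-approx B (app r (Approx-refl (genT A)))

star-approx : Approx k star N → N ≡ star
star-approx star = refl

Approx-rename : ∀ ρ → Approx k M M′ → Approx k (rename ρ M) (rename ρ M′)
Approx-rename ρ var       = var
Approx-rename ρ (lam r)   = lam (Approx-rename (ext ρ) r)
Approx-rename ρ (app r q) = app (Approx-rename ρ r) (Approx-rename ρ q)
Approx-rename ρ star      = star
Approx-rename ρ (r ▷ q)   = Approx-rename ρ r ▷ Approx-rename ρ q
Approx-rename ρ gen       = gen
Approx-rename ρ (ver r)   = ver (Approx-rename ρ r)
Approx-rename ρ (gen-atom {a = a} r) = gen-atom (verT-↠-rename ρ (atom a) r)
Approx-rename {k} ρ (gen-⇒ {A = A} {B} {N} sz r) =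
  ≡-subst (λ G → Approx k G (rename ρ N)) (sym (rename-genT ρ (A ⇒ B)))
    (gen-⇒ sz (verT-↠-rename ρ (A ⇒ B) r))
Approx-rename {k} ρ (gen-⇒-applied {A = A} {B} {N} {X} {Q = Q} sz r q red) =
  ≡-subst (λ G → Approx k (rename ρ X ▷ G) (app (rename ρ N) (rename ρ Q)))
    (sym (rename-genT ρ B))
    (gen-⇒-applied sz (verT-↠-rename ρ (A ⇒ B) r) (Approx-rename ρ q)
      (verT-↠-rename ρ A red))

Approx-subst : (∀ x → Approx k (s x) (t x)) → Approx k M M′ → Approx k (subst s M) (subst t M′)
Approx-subst st var       = st _
Approx-subst st (lam r)   = lam (Approx-subst exts-approx r)
  where
  exts-approx : ∀ x → Approx _ (exts _ x) (exts _ x)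
  exts-approx zero    = var
  exts-approx (suc x) = Approx-rename suc (st x)
Approx-subst st (app r q) = app (Approx-subst st r) (Approx-subst st q)
Approx-subst st star      = star
Approx-subst st (r ▷ q)   = Approx-subst st r ▷ Approx-subst st q
Approx-subst st gen       = gen
Approx-subst st (ver r)   = ver (Approx-subst st r)
Approx-subst {t = t} st (gen-atom {a = a} r) = gen-atom (verT-↠-subst t (atom a) r)
Approx-subst {k} {s} {t} st (gen-⇒ {A = A} {B} {N} sz r) =
  ≡-subst (λ G → Approx k G (subst t N)) (sym (subst-genT s (A ⇒ B)))
    (gen-⇒ sz (verT-↠-subst t (A ⇒ B) r))
Approx-subst {k} {s} {t} st (gen-⇒-applied {A = A} {B} {N} {X} {Q = Q} sz r q red) =
  ≡-subst (λ G → Approx k (subst s X ▷ G) (app (subst t N) (subst t Q)))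
    (sym (subst-genT s B))
    (gen-⇒-applied sz (verT-↠-subst t (A ⇒ B) r) (Approx-subst st q)
      (verT-↠-subst t A red))

Approx-[] : Approx k M M′ → Approx k P P′ → Approx k (M [ P ]) (M′ [ P′ ])
Approx-[] {k} {M} {M′} {P} {P′} r q =
  subst₂ (Approx k) (sym ([]-as-subst M P)) (sym ([]-as-subst M′ P′))
    (Approx-subst single-approx r)
  where
  single-approx : ∀ x → Approx k (singleSubst P x) (singleSubst P′ x)
  single-approx zero    = q
  single-approx (suc x) = var

ApproxPreservesStar : ℕ → Set
ApproxPreservesStar k = ∀ {M N} → Approx k M N → M ↠ star → N ↠ star

gen-⇒-applied-star : (∀ {j} → j < k → ApproxPreservesStar j) →
                     size (A ⇒ B) ≤ k → verT (A ⇒ B) N ↠ star → verT A Q ↠ star →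
                     Approx k (genT B) (app N Q)
gen-⇒-applied-star {A = A} {B} {N} ih sz verN verQ =
  genT-approx B (cod-size≤ sz)
    (ih (dom-size< sz) (verT-approx B (app (Approx-refl N) (genT-approx A ≤-refl verQ))) verN)

simulate : (∀ {j} → j < k → ApproxPreservesStar j) →
           Approx k M N → M ⟶ M₁ → ∃[ N₁ ] (N ↠ N₁ × Approx k M₁ N₁)
simulate ih (lam r) (ξ-lam step) with simulate ih r step
... | N₁ , red , r₁ = lam N₁ , gmap lam ξ-lam red , lam r₁
simulate ih (app {N′ = Q′} r q) (ξ-appˡ step) with simulate ih r step
... | N₁ , red , r₁ = app N₁ Q′ , gmap (λ T → app T Q′) ξ-appˡ red , app r₁ q
simulate ih (app {M′ = P′} r q) (ξ-appʳ step) with simulate ih q step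
... | N₁ , red , q₁ = app P′ N₁ , gmap (app P′) ξ-appʳ red , app r q₁
simulate ih (app (lam r) q) β = _ , β ◅ ε , Approx-[] r q
simulate {k} ih (app {N = P} {N′ = P′} (gen-⇒ {A = A} {B} {N} sz verN) q) β =
  app N P′ , ε ,
  ≡-subst (λ T → Approx k T (app N P′)) (sym (genT-⇒-[] A B P))
    (gen-⇒-applied sz verN (verT-approx A q) ε)
simulate ih (_▷_ {N′ = Q′} r q) (ξ-▷ˡ step) with simulate ih r step
... | N₁ , red , r₁ = N₁ ▷ Q′ , gmap (_▷ Q′) ξ-▷ˡ red , r₁ ▷ q
simulate ih (_▷_ {M′ = P′} r q) (ξ-▷ʳ step) with simulate ih q step
... | N₁ , red , q₁ = P′ ▷ N₁ , gmap (P′ ▷_) ξ-▷ʳ red , r ▷ q₁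
simulate ih (r ▷ q) ▷-star with star-approx r
... | refl = _ , ▷-star ◅ ε , q
simulate ih (ver {a = a} r) (ξ-ver step) with simulate ih r step
... | N₁ , red , r₁ = ver a N₁ , gmap (ver a) ξ-ver red , ver r₁
simulate ih (ver gen) ver-gen = star , ver-gen ◅ ε , star
simulate ih (ver (gen-atom verN)) ver-gen = star , verN , star
simulate ih (gen-⇒ {A = A} {B} _ _) step = ⊥-elim (genT-normal (A ⇒ B) step)
simulate ih (gen-⇒-applied sz verN r verQ) (ξ-▷ˡ step) with simulate ih r step
... | N₁ , red , r₁ = _ , ε , gen-⇒-applied sz verN r₁ (verQ ◅◅ red)
simulate ih (gen-⇒-applied {B = B} _ _ _ _) (ξ-▷ʳ step) = ⊥-elim (genT-normal B step)
simulate ih (gen-⇒-applied sz verN r verQ) ▷-star with star-approx r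
... | refl = _ , ε , gen-⇒-applied-star ih sz verN verQ

approx-preserves-star : ∀ k → ApproxPreservesStar k
approx-preserves-star = <-rec ApproxPreservesStar preserve
  where
  preserve : ∀ k → (∀ {j} → j < k → ApproxPreservesStar j) → ApproxPreservesStar k
  preserve k ih r ε with star-approx r
  ... | refl = ε
  preserve k ih r (step ◅ steps) with simulate ih r step
  ... | N₁ , red , r₁ = red ◅◅ preserve k ih r₁ steps

maxSize : Env → ℕ
maxSize []            = zero
maxSize ((x , A) ∷ Γ) = size A ⊔ maxSize Γ

size≤maxSize : ∀ {Γ} → (x , A) ∈ Γ → size A ≤ maxSize Γ
size≤maxSize {Γ = (y , B) ∷ Γ} (here refl) = m≤m⊔n (size B) (maxSize Γ)
size≤maxSize {Γ = (y , B) ∷ Γ} (there p)   = ≤-trans (size≤maxSize p) (m≤n⊔m (size B) (maxSize Γ))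

lookupEnv-∈ : ∀ Γ x → lookupEnv Γ x ≡ just A → (x , A) ∈ Γ
lookupEnv-∈ ((y , B) ∷ Γ) x eq with x ≟ y
lookupEnv-∈ ((y , B) ∷ Γ) x refl | yes refl = here refl
lookupEnv-∈ ((y , B) ∷ Γ) x eq   | no _     = there (lookupEnv-∈ Γ x eq)

toSub-just : ∀ σ x → σ x ≡ just N → toSub σ x ≡ N
toSub-just σ x eq with σ x
toSub-just σ x refl | just _ = refl

envSubst-approx : ∀ Γ σ → Compatible Γ σ →
                  ∀ x → Approx (maxSize Γ) (subst (toSub σ) (toSub (envSubst Γ) x)) (toSub σ x)
envSubst-approx Γ σ compat x with lookupEnv Γ x in eq
... | nothing = Approx-refl (toSub σ x)
... | just A with compat x A (lookupEnv-∈ Γ x eq)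
...   | N , σx≡N , verN =
  subst₂ (Approx (maxSize Γ)) (sym (subst-genT (toSub σ) A)) (sym (toSub-just σ x σx≡N))
    (genT-approx A (size≤maxSize (lookupEnv-∈ Γ x eq)) verN)

lemma3p10 : (Γ : Env) (σ : Subst) (M : Tm) →
    IsEnv Γ → Compatible Γ σ → (M ^ᴱ Γ) ↠ star → (M ^ σ) ↠ star
lemma3p10 Γ σ M _ compat M^Γ↠star =
  approx-preserves-star (maxSize Γ)
    (Approx-subst (envSubst-approx Γ σ compat) (Approx-refl M)) M^Γ^σ↠star
  where
  M^Γ^σ↠star : subst (subst (toSub σ) ∘ toSub (envSubst Γ)) M ↠ star
  M^Γ^σ↠star = ≡-subst (_↠ star) (subst-subst (toSub σ) (toSub (envSubst Γ)) M)
                 (↠-subst (toSub σ) M^Γ↠star)
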